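{- For all modal trees $\mathtt{T},\mathtt{T}'$: if $\mathtt{T}\hookrightarrow\mathtt{T}'$ (a single rewriting step of $\mathsf{TRC}$), then $\mathscr{F}(\mathtt{T})\vdash_{\mathbf{RC}}\mathscr{F}(\mathtt{T}')$.
   Context: Strictly positive formulas $\mathcal{L}^+$: $\varphi::=\top\mid p\mid\langle\alpha\rangle\varphi\mid(\varphi\wedge\varphi)$ with $p$ a propositional variable and $\alpha<\omega$. $\mathbf{K}^+$ has axioms $\varphi\vdash\varphi$, $\varphi\vdash\top$, $\varphi\wedge\psi\vdash\varphi$, $\varphi\wedge\psi\vdash\psi$, and rules: from $\varphi\vdash\psi$ and $\psi\vdash\chi$ infer $\varphi\vdash\chi$; from $\varphi\vdash\psi$ and $\varphi\vdash\chi$ infer $\varphi\vdash\psi\wedge\chi$; from $\varphi\vdash\psi$ infer $\langle\alpha\rangle\varphi\vdash\langle\alpha\rangle\psi$. $\mathbf{RC}$ extends $\mathbf{K}^+$ by axioms $\langle\alpha\rangle\langle\alpha\rangle\varphi\vdash\langle\alpha\rangle\varphi$; $\langle\alpha\rangle\varphi\vdash\langle\beta\rangle\varphi$ for $\alpha>\beta$; $\langle\alpha\rangle\varphi\wedge\langle\beta\rangle\psi\vdash\langle\alpha\rangle(\varphi\wedge\langle\beta\rangle\psi)$ for $\alpha>\beta$. Modal trees: recursively, pairs $\langle\Delta;\Gamma\rangle$ with $\Delta$ a finite list of propositional variables and $\Gamma$ a finite list of pairs $(\alpha,\mathtt{S})$, $\alpha<\omega$, $\mathtt{S}$ a modal tree.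 For a finite list $\Pi$ of formulas, $\bigwedge\varnothing=\top$, $\bigwedge(\varphi\frown\Pi)=\varphi\wedge\bigwedge\Pi$. $\mathscr{F}(\langle\Delta;\Gamma\rangle):=\bigwedge\Delta\wedge\bigwedge[\langle\alpha\rangle\mathscr{F}(\mathtt{S})\mid(\alpha,\mathtt{S})\in\Gamma]$. Positions: $\mathrm{Pos}(\langle\Delta;\varnothing\rangle)=\{\epsilon\}$; $\mathrm{Pos}(\langle\Delta;[(\alpha_1,\mathtt{S}_1),\dots,(\alpha_n,\mathtt{S}_n)]\rangle)=\{\epsilon\}\cup\bigcup_{i=1}^n\{i\mathbf{k}\mid\mathbf{k}\in\mathrm{Pos}(\mathtt{S}_i)\}$. Subtree: $\mathtt{T}|_\epsilon=\mathtt{T}$, $\mathtt{T}|_{i\mathbf{r}}=\mathtt{S}_i|_{\mathbf{r}}$. Replacement: $\mathtt{T}[\mathtt{S}]_\epsilon=\mathtt{S}$, $\mathtt{T}[\mathtt{S}]_{i\mathbf{r}}$ is $\mathtt{T}$ with its $i$-th child $\mathtt{S}_i$ replaced by $\mathtt{S}_i[\mathtt{S}]_{\mathbf{r}}$ (same edge label). List operations, for $0<i,j\le|\Gamma|$: $\#_i\Gamma$ is the $i$-th element; $\Gamma^{ -i}$ deletes it; $\Gamma^{+i}=(\#_i\Gamma)\frown\Gamma$; $\Gamma[x]_i$ replaces the $i$-th element by $x$; $\Gamma^{i\leftrightarrow j}$ swaps the $i$-th and $j$-th elements; similarly $\Delta^{ -n},\Delta^{+n}$. $\mathsf{TRC}$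 rules: for a modal tree $\mathtt{T}$, $\mathbf{k}\in\mathrm{Pos}(\mathtt{T})$ with $\mathtt{T}|_\mathbf{k}=\langle\Delta;\Gamma\rangle$: ($\rho^+$) $\mathtt{T}\hookrightarrow\mathtt{T}[\langle\Delta^{+i};\Gamma\rangle]_\mathbf{k}$, $0<i\le|\Delta|$; ($\rho^-$) $\mathtt{T}\hookrightarrow\mathtt{T}[\langle\Delta^{ -i};\Gamma\rangle]_\mathbf{k}$; ($\sigma$) $\mathtt{T}\hookrightarrow\mathtt{T}[\langle\Delta;\Gamma^{i\leftrightarrow j}\rangle]_\mathbf{k}$, $i\neq j$; ($\pi^+$) $\mathtt{T}\hookrightarrow\mathtt{T}[\langle\Delta;\Gamma^{+i}\rangle]_\mathbf{k}$; ($\pi^-$) $\mathtt{T}\hookrightarrow\mathtt{T}[\langle\Delta;\Gamma^{ -i}\rangle]_\mathbf{k}$; ($\mathfrak{4}$) if $\#_i\Gamma=(\beta,\langle\tilde\Delta;\tilde\Gamma\rangle)$ and $\#_j\tilde\Gamma=(\beta,\mathtt{S})$, then $\mathtt{T}\hookrightarrow\mathtt{T}[\langle\Delta;\Gamma[(\beta,\mathtt{S})]_i\rangle]_\mathbf{k}$; ($\lambda$) if $\#_i\Gamma=(\alpha,\mathtt{S})$ and $\alpha>\beta$, then $\mathtt{T}\hookrightarrow\mathtt{T}[\langle\Delta;\Gamma[(\beta,\mathtt{S})]_i\rangle]_\mathbf{k}$; ($\mathsf{J}$) if $i\ne j$, $\#_i\Gamma=(\alpha,\langle\tilde\Delta;\tilde\Gamma\rangle)$,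 $\#_j\Gamma=(\beta,\mathtt{S})$, $\alpha>\beta$, then $\mathtt{T}\hookrightarrow\mathtt{T}[\langle\Delta;(\Gamma[(\alpha,\langle\tilde\Delta;\tilde\Gamma\frown(\beta,\mathtt{S})\rangle)]_i)^{ -j}\rangle]_\mathbf{k}$. $\hookrightarrow$ is the union of these relations. -}

module Defs where

open import Data.Nat using (ℕ; zero; suc; _>_)
open import Data.List using (List; []; _∷_; map; _++_; [_])
open import Data.Product using (_×_; _,_)
open import Data.Maybe using (Maybe; just; nothing)
open import Relation.Binary.PropositionalEquality using (_≡_; _≢_)

-- Strictly positive formulas; propositional variables are natural numbers,
-- modalities ⟨α⟩ for α < ω are indexed by ℕ.

data Fm : Set where
  ⊤'   : Fm
  var  : ℕ → Fm
  ⟨_⟩_ : ℕ → Fm → Fm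
  _∧_  : Fm → Fm → Fm

infixr 6 _∧_
infix 4 _⊢_

data _⊢_ : Fm → Fm → Set where
  refl⊢  : ∀ {φ} → φ ⊢ φ
  top    : ∀ {φ} → φ ⊢ ⊤'
  ∧-el   : ∀ {φ ψ} → φ ∧ ψ ⊢ φ
  ∧-er   : ∀ {φ ψ} → φ ∧ ψ ⊢ ψ
  cut    : ∀ {φ ψ χ} → φ ⊢ ψ → ψ ⊢ χ → φ ⊢ χ
  ∧-intro : ∀ {φ ψ χ} → φ ⊢ ψ → φ ⊢ χ → φ ⊢ ψ ∧ χ
  nec    : ∀ {φ ψ} α → φ ⊢ ψ → ⟨ α ⟩ φ ⊢ ⟨ α ⟩ ψ
  trans4 : ∀ {φ} α → ⟨ α ⟩ ⟨ α ⟩ φ ⊢ ⟨ α ⟩ φ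
  mono   : ∀ {φ} α β → α > β → ⟨ α ⟩ φ ⊢ ⟨ β ⟩ φ
  J      : ∀ {φ ψ} α β → α > β →
           ⟨ α ⟩ φ ∧ ⟨ β ⟩ ψ ⊢ ⟨ α ⟩ (φ ∧ ⟨ β ⟩ ψ)

data Tree : Set where
  node : List ℕ → List (ℕ × Tree) → Tree

⋀ : List Fm → Fm
⋀ []      = ⊤'
⋀ (φ ∷ Π) = φ ∧ ⋀ Π

mutual
  𝓕 : Tree → Fm
  𝓕 (node Δ Γ) = ⋀ (map var Δ) ∧ ⋀ (𝓕s Γ)

  𝓕s : List (ℕ × Tree) → List Fm
  𝓕s []            = []
  𝓕s ((α , S) ∷ Γ) = ⟨ α ⟩ 𝓕 S ∷ 𝓕s Γ

-- List operations with 1-based indices (as in the paper).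
-- nth xs i = just (#_i xs) when 0 < i ≤ |xs|, nothing otherwise.

nth : {A : Set} → List A → ℕ → Maybe A
nth []       _             = nothing
nth (x ∷ xs) zero          = nothing
nth (x ∷ xs) (suc zero)    = just x
nth (x ∷ xs) (suc (suc n)) = nth xs (suc n)

setAt : {A : Set} → List A → ℕ → A → List A
setAt []       _             y = []
setAt (x ∷ xs) zero          y = x ∷ xs
setAt (x ∷ xs) (suc zero)    y = y ∷ xs
setAt (x ∷ xs) (suc (suc n)) y = x ∷ setAt xs (suc n) y

delAt : {A : Set} → List A → ℕ → List A
delAt []       _             = []
delAt (x ∷ xs) zero          = x ∷ xs
delAt (x ∷ xs) (suc zero)    = xs
delAt (x ∷ xs) (suc (suc n)) = x ∷ delAt xs (suc n)

-- Positions (lists of 1-based child indices), subtrees, replacement.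
-- subtree T k = just (T|_k) iff k ∈ Pos(T).

mutual
  subtree : Tree → List ℕ → Maybe Tree
  subtree T          []      = just T
  subtree (node Δ Γ) (i ∷ r) = subtreeL Γ i r

  subtreeL : List (ℕ × Tree) → ℕ → List ℕ → Maybe Tree
  subtreeL []            _             r = nothing
  subtreeL (x ∷ Γ)       zero          r = nothing
  subtreeL ((α , S) ∷ Γ) (suc zero)    r = subtree S r
  subtreeL (x ∷ Γ)       (suc (suc n)) r = subtreeL Γ (suc n) r

mutual
  replace : Tree → List ℕ → Tree → Tree
  replace T          []      S = S
  replace (node Δ Γ) (i ∷ r) S = node Δ (replaceL Γ i r S)

  replaceL : List (ℕ × Tree) → ℕ → List ℕ → Tree → List (ℕ × Tree)
  replaceL []            _             r S = []
  replaceL (x ∷ Γ)       zero          r S = x ∷ Γ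
  replaceL ((α , U) ∷ Γ) (suc zero)    r S = (α , replace U r S) ∷ Γ
  replaceL (x ∷ Γ)       (suc (suc n)) r S = x ∷ replaceL Γ (suc n) r S

data Local : Tree → Tree → Set where
  ρ⁺ : ∀ {Δ Γ} i p → nth Δ i ≡ just p →
       Local (node Δ Γ) (node (p ∷ Δ) Γ)
  ρ⁻ : ∀ {Δ Γ} i p → nth Δ i ≡ just p →
       Local (node Δ Γ) (node (delAt Δ i) Γ)
  σ  : ∀ {Δ Γ} i j x y → i ≢ j → nth Γ i ≡ just x → nth Γ j ≡ just y →
       Local (node Δ Γ) (node Δ (setAt (setAt Γ i y) j x))
  π⁺ : ∀ {Δ Γ} i x → nth Γ i ≡ just x →
       Local (node Δ Γ) (node Δ (x ∷ Γ))
  π⁻ : ∀ {Δ Γ} i x → nth Γ i ≡ just x →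
       Local (node Δ Γ) (node Δ (delAt Γ i))
  𝔣4 : ∀ {Δ Γ Δ̃ Γ̃ S} i j β →
       nth Γ i ≡ just (β , node Δ̃ Γ̃) → nth Γ̃ j ≡ just (β , S) →
       Local (node Δ Γ) (node Δ (setAt Γ i (β , S)))
  λ' : ∀ {Δ Γ S} i α β → α > β → nth Γ i ≡ just (α , S) →
       Local (node Δ Γ) (node Δ (setAt Γ i (β , S)))
  J' : ∀ {Δ Γ Δ̃ Γ̃ S} i j α β → i ≢ j → α > β →
       nth Γ i ≡ just (α , node Δ̃ Γ̃) → nth Γ j ≡ just (β , S) →
       Local (node Δ Γ)
             (node Δ (delAt (setAt Γ i (α , node Δ̃ (Γ̃ ++ [ β , S ]))) j))

data _↪_ : Tree → Tree → Set where
  step : ∀ {T Δ Γ S'} (k : List ℕ) →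
         subtree T k ≡ just (node Δ Γ) →
         Local (node Δ Γ) S' →
         T ↪ replace T k S'

-- At the rewritten node every conjunct of the new formula follows from the
-- conjuncts of the old one: ρ±, σ, π± only duplicate, permute or drop
-- conjuncts, while 𝔣4, λ and J replace one child ⟨α⟩𝓕(S) by a consequence
-- of the RC axiom of the same name. Since 𝓕 is monotone in every subtree
-- (by necessitation), the local step lifts to the whole tree.
module Submission where

open import Defs
open import Data.Nat using (ℕ; zero; suc)
open import Data.List using (List; []; _∷_; map; _++_; [_])
open import Data.List.Membership.Propositional using (_∈_)
open import Data.List.Membership.Propositional.Properties using (∈-++⁻)
open import Data.List.Relation.Binary.Subset.Propositional using (_⊆_)
open import Data.List.Relation.Binary.Subset.Propositional.Properties using (⊆-refl; ∈-∷⁺ʳ)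
open import Data.List.Relation.Unary.Any using (here; there)
open import Data.Maybe using (just)
open import Data.Product using (_×_; _,_)
open import Data.Sum using (_⊎_; inj₁; inj₂)
open import Relation.Binary.PropositionalEquality using (_≡_; refl; cong; subst)

∧-mono : ∀ {φ φ′ ψ ψ′} → φ ⊢ φ′ → ψ ⊢ ψ′ → φ ∧ ψ ⊢ φ′ ∧ ψ′
∧-mono φ⊢φ′ ψ⊢ψ′ = ∧-intro (cut ∧-el φ⊢φ′) (cut ∧-er ψ⊢ψ′)

⟨⟩-absorb : ∀ {φ ψ} α → φ ⊢ ⟨ α ⟩ ψ → ⟨ α ⟩ φ ⊢ ⟨ α ⟩ ψ
⟨⟩-absorb α φ⊢ψ = cut (nec α φ⊢ψ) (trans4 α)

⋀-map-∈ : ∀ {A : Set} (f : A → Fm) {x xs} → x ∈ xs → ⋀ (map f xs) ⊢ f x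
⋀-map-∈ f (here refl) = ∧-el
⋀-map-∈ f (there x∈xs) = cut ∧-er (⋀-map-∈ f x∈xs)

⋀-map-intro : ∀ {A : Set} (f : A → Fm) {φ} xs →
              (∀ {x} → x ∈ xs → φ ⊢ f x) → φ ⊢ ⋀ (map f xs)
⋀-map-intro f []       h = top
⋀-map-intro f (x ∷ xs) h = ∧-intro (h (here refl)) (⋀-map-intro f xs (λ y∈xs → h (there y∈xs)))

⋀-map-⊆ : ∀ {A : Set} (f : A → Fm) {xs} ys → ys ⊆ xs → ⋀ (map f xs) ⊢ ⋀ (map f ys)
⋀-map-⊆ f ys ys⊆xs = ⋀-map-intro f ys (λ y∈ys → ⋀-map-∈ f (ys⊆xs y∈ys))

nth⇒∈ : ∀ {A : Set} (xs : List A) i {x} → nth xs i ≡ just x → x ∈ xs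
nth⇒∈ (y ∷ xs) (suc zero)    refl = here refl
nth⇒∈ (y ∷ xs) (suc (suc i)) eq   = there (nth⇒∈ xs (suc i) eq)

∈-setAt⁻ : ∀ {A : Set} (xs : List A) i y {x} → x ∈ setAt xs i y → x ≡ y ⊎ x ∈ xs
∈-setAt⁻ (z ∷ xs) zero          y x∈         = inj₂ x∈
∈-setAt⁻ (z ∷ xs) (suc zero)    y (here eq)  = inj₁ eq
∈-setAt⁻ (z ∷ xs) (suc zero)    y (there x∈) = inj₂ (there x∈)
∈-setAt⁻ (z ∷ xs) (suc (suc i)) y (here eq)  = inj₂ (here eq)
∈-setAt⁻ (z ∷ xs) (suc (suc i)) y (there x∈) with ∈-setAt⁻ xs (suc i) y x∈
... | inj₁ eq  = inj₁ eq
... | inj₂ x∈′ = inj₂ (there x∈′)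

setAt-⊆ : ∀ {A : Set} {xs ys : List A} i {y} → y ∈ ys → xs ⊆ ys → setAt xs i y ⊆ ys
setAt-⊆ {xs = xs} i {y} y∈ys xs⊆ys x∈ with ∈-setAt⁻ xs i y x∈
... | inj₁ refl = y∈ys
... | inj₂ x∈xs = xs⊆ys x∈xs

delAt-⊆ : ∀ {A : Set} (xs : List A) i → delAt xs i ⊆ xs
delAt-⊆ (z ∷ xs) zero          x∈         = x∈
delAt-⊆ (z ∷ xs) (suc zero)    x∈         = there x∈
delAt-⊆ (z ∷ xs) (suc (suc i)) (here eq)  = here eq
delAt-⊆ (z ∷ xs) (suc (suc i)) (there x∈) = there (delAt-⊆ xs (suc i) x∈)

edge : ℕ × Tree → Fm
edge (α , S) = ⟨ α ⟩ 𝓕 S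

𝓕s≡map-edge : ∀ Γ → 𝓕s Γ ≡ map edge Γ
𝓕s≡map-edge []            = refl
𝓕s≡map-edge ((α , S) ∷ Γ) = cong (⟨ α ⟩ 𝓕 S ∷_) (𝓕s≡map-edge Γ)

⋀𝓕s-∈ : ∀ {Γ x} → x ∈ Γ → ⋀ (𝓕s Γ) ⊢ edge x
⋀𝓕s-∈ {Γ} x∈Γ rewrite 𝓕s≡map-edge Γ = ⋀-map-∈ edge x∈Γ

⋀𝓕s-intro : ∀ {φ} Γ → (∀ {x} → x ∈ Γ → φ ⊢ edge x) → φ ⊢ ⋀ (𝓕s Γ)
⋀𝓕s-intro Γ h rewrite 𝓕s≡map-edge Γ = ⋀-map-intro edge Γ h

𝓕-child : ∀ {Δ Γ x} → x ∈ Γ → 𝓕 (node Δ Γ) ⊢ edge x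
𝓕-child x∈Γ = cut ∧-er (⋀𝓕s-∈ x∈Γ)

𝓕-snoc : ∀ {Δ Γ} β S → 𝓕 (node Δ Γ) ∧ ⟨ β ⟩ 𝓕 S ⊢ 𝓕 (node Δ (Γ ++ [ β , S ]))
𝓕-snoc {Δ} {Γ} β S = ∧-intro (cut ∧-el ∧-el) (⋀𝓕s-intro (Γ ++ [ β , S ]) child)
  where
  child : ∀ {x} → x ∈ Γ ++ [ β , S ] → 𝓕 (node Δ Γ) ∧ ⟨ β ⟩ 𝓕 S ⊢ edge x
  child x∈ with ∈-++⁻ Γ x∈
  ... | inj₁ x∈Γ         = cut ∧-el (𝓕-child x∈Γ)
  ... | inj₂ (here refl) = ∧-er

infix 4 _⊩_

_⊩_ : List (ℕ × Tree) → List (ℕ × Tree) → Set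
Γ ⊩ Γ′ = ∀ {x} → x ∈ Γ′ → ⋀ (𝓕s Γ) ⊢ edge x

⊆⇒⊩ : ∀ {Γ Γ′} → Γ′ ⊆ Γ → Γ ⊩ Γ′
⊆⇒⊩ Γ′⊆Γ x∈Γ′ = ⋀𝓕s-∈ (Γ′⊆Γ x∈Γ′)

setAt-⊩ : ∀ {Γ} i {y} → ⋀ (𝓕s Γ) ⊢ edge y → Γ ⊩ setAt Γ i y
setAt-⊩ {Γ} i {y} ⊢y x∈ with ∈-setAt⁻ Γ i y x∈
... | inj₁ refl = ⊢y
... | inj₂ x∈Γ  = ⋀𝓕s-∈ x∈Γ

node-labels-⊆ : ∀ {Δ Δ′ Γ} → Δ′ ⊆ Δ → 𝓕 (node Δ Γ) ⊢ 𝓕 (node Δ′ Γ)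
node-labels-⊆ {Δ′ = Δ′} Δ′⊆Δ = ∧-mono (⋀-map-⊆ var Δ′ Δ′⊆Δ) refl⊢

node-children-⊩ : ∀ {Δ Γ Γ′} → Γ ⊩ Γ′ → 𝓕 (node Δ Γ) ⊢ 𝓕 (node Δ Γ′)
node-children-⊩ {Γ′ = Γ′} Γ⊩Γ′ = ∧-mono refl⊢ (⋀𝓕s-intro Γ′ Γ⊩Γ′)

Local-sound : ∀ {A B} → Local A B → 𝓕 A ⊢ 𝓕 B
Local-sound {node Δ Γ} (ρ⁺ i p eq) = node-labels-⊆ (∈-∷⁺ʳ (nth⇒∈ Δ i eq) ⊆-refl)
Local-sound {node Δ Γ} (ρ⁻ i p eq) = node-labels-⊆ (delAt-⊆ Δ i)
Local-sound {node Δ Γ} (σ i j x y _ eqx eqy) =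
  node-children-⊩ (⊆⇒⊩ (setAt-⊆ j (nth⇒∈ Γ i eqx) (setAt-⊆ i (nth⇒∈ Γ j eqy) ⊆-refl)))
Local-sound {node Δ Γ} (π⁺ i x eq) = node-children-⊩ (⊆⇒⊩ (∈-∷⁺ʳ (nth⇒∈ Γ i eq) ⊆-refl))
Local-sound {node Δ Γ} (π⁻ i x eq) = node-children-⊩ (⊆⇒⊩ (delAt-⊆ Γ i))
Local-sound {node Δ Γ} (𝔣4 {Γ̃ = Γ̃} i j β eqᵢ eqⱼ) =
  node-children-⊩ (setAt-⊩ i (cut (⋀𝓕s-∈ (nth⇒∈ Γ i eqᵢ))
                                  (⟨⟩-absorb β (𝓕-child (nth⇒∈ Γ̃ j eqⱼ)))))
Local-sound {node Δ Γ} (λ' i α β α>β eq) =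
  node-children-⊩ (setAt-⊩ i (cut (⋀𝓕s-∈ (nth⇒∈ Γ i eq)) (mono α β α>β)))
Local-sound {node Δ Γ} (J' {S = S} i j α β _ α>β eqᵢ eqⱼ) =
  node-children-⊩ (λ x∈ → merged (delAt-⊆ _ j x∈))
  where
  merged : Γ ⊩ setAt Γ i _
  merged = setAt-⊩ i (cut (∧-intro (⋀𝓕s-∈ (nth⇒∈ Γ i eqᵢ)) (⋀𝓕s-∈ (nth⇒∈ Γ j eqⱼ)))
                          (cut (J α β α>β) (nec α (𝓕-snoc β S))))

mutual
  replace-cong : ∀ T k {A B} → 𝓕 A ⊢ 𝓕 B → 𝓕 (replace T k A) ⊢ 𝓕 (replace T k B)
  replace-cong T          []      A⊢B = A⊢B
  replace-cong (node Δ Γ) (i ∷ k) A⊢B = ∧-mono refl⊢ (replaceL-cong Γ i k A⊢B)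

  replaceL-cong : ∀ Γ i k {A B} → 𝓕 A ⊢ 𝓕 B →
                  ⋀ (𝓕s (replaceL Γ i k A)) ⊢ ⋀ (𝓕s (replaceL Γ i k B))
  replaceL-cong []            _             k A⊢B = refl⊢
  replaceL-cong (x ∷ Γ)       zero          k A⊢B = refl⊢
  replaceL-cong ((α , U) ∷ Γ) (suc zero)    k A⊢B = ∧-mono (nec α (replace-cong U k A⊢B)) refl⊢
  replaceL-cong (x ∷ Γ)       (suc (suc i)) k A⊢B = ∧-mono refl⊢ (replaceL-cong Γ (suc i) k A⊢B)

mutual
  replace-subtree : ∀ T k {A} → subtree T k ≡ just A → replace T k A ≡ T
  replace-subtree T          []      refl = refl
  replace-subtree (node Δ Γ) (i ∷ k) eq   = cong (node Δ) (replaceL-subtreeL Γ i k eq)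

  replaceL-subtreeL : ∀ Γ i k {A} → subtreeL Γ i k ≡ just A → replaceL Γ i k A ≡ Γ
  replaceL-subtreeL ((α , U) ∷ Γ) (suc zero)    k eq =
    cong (λ U′ → (α , U′) ∷ Γ) (replace-subtree U k eq)
  replaceL-subtreeL (x ∷ Γ)       (suc (suc i)) k eq =
    cong (x ∷_) (replaceL-subtreeL Γ (suc i) k eq)

mainTheorem6 : ∀ (T T′ : Tree) → T ↪ T′ → 𝓕 T ⊢ 𝓕 T′
mainTheorem6 T _ (step {S' = S′} k T|k≡ local) =
  subst (λ T₀ → 𝓕 T₀ ⊢ 𝓕 (replace T k S′))
        (replace-subtree T k T|k≡)
        (replace-cong T k (Local-sound local))
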